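{- Let $G=(X\cup Y,E)$ be a simple $d$-regular $n$-vertex bipartite graph with classes $X$ and $Y$. For every $\ell\ge0$ and every vector ${\bf u}=(u_1,\ldots,u_\ell)\in\{0,1\}^\ell$, we have $|\Psi_{{\bf u},X}|=|\Psi_{{\bf u},Y}|$.
   Context: An alternating closed walk of length $\ell$ is a sequence $(v_1,v_2,\ldots,v_\ell,v_{\ell+1})$ of vertices of $G$ with $v_{\ell+1}=v_1$ in which every two consecutive vertices lie in different classes (one in $X$, one in $Y$). Such a sequence obeys ${\bf u}$ if for every $i\in\{1,\ldots,\ell\}$, $\{v_i,v_{i+1}\}\in E$ iff $u_i=1$. $\Psi_{{\bf u},X}$ (resp. $\Psi_{{\bf u},Y}$) is the set of alternating closed walks of length $\ell$ obeying ${\bf u}$ with $v_1\in X$ (resp. $v_1\in Y$). -}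

module Defs where

open import Data.Nat using (ℕ; zero; suc)
open import Data.Bool using (Bool; true; false; _∧_; not; if_then_else_)
open import Data.Bool.Properties using () renaming (_≟_ to _≟ᵇ_)
open import Data.Fin using (Fin; zero; suc; inject₁; fromℕ)
open import Data.Vec using (Vec; []; _∷_; lookup)
open import Data.List using (List; []; _∷_; [_]; map; concatMap; allFin; filterᵇ; length)
open import Relation.Binary.PropositionalEquality using (_≡_; _≢_)
open import Relation.Nullary.Decidable using (⌊_⌋)

-- A simple bipartite graph on vertex set Fin n.
--   E     : adjacency (Bool-valued), symmetric and loopless (simple graph)
--   inX v : true iff v belongs to class X (false: v belongs to class Y)
record BipartiteGraph (n : ℕ) : Set where
  field
    E     : Fin n → Fin n → Bool
    inX   : Fin n → Bool
    E-sym : ∀ u v → E u v ≡ E v u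
    E-irr : ∀ v → E v v ≡ false
    E-bip : ∀ u v → E u v ≡ true → inX u ≢ inX v

open BipartiteGraph public

degree : ∀ {n} → BipartiteGraph n → Fin n → ℕ
degree {n} G v = length (filterᵇ (E G v) (allFin n))

Regular : ∀ {n} → BipartiteGraph n → ℕ → Set
Regular G d = ∀ v → degree G v ≡ d

allSeqs : ∀ n k → List (Vec (Fin n) k)
allSeqs n zero = [ [] ]
allSeqs n (suc k) = concatMap (λ x → map (x ∷_) (allSeqs n k)) (allFin n)

-- A sequence (v₁,…,v_{ℓ+1}) (as a vector of length ℓ+1, index i ↦ v_{i+1})
-- is an alternating closed walk of length ℓ obeying u:
--   v_{ℓ+1} = v₁, consecutive vertices lie in different classes,
--   and {v_i,v_{i+1}} ∈ E iff u_i = 1 (u_i = true).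
stepsOK : ∀ {n} → BipartiteGraph n → ∀ ℓ → Vec Bool ℓ → Vec (Fin n) (suc ℓ) → Bool
stepsOK G zero [] w = true
stepsOK G (suc ℓ) (b ∷ u) (x ∷ y ∷ w) =
  not ⌊ inX G x ≟ᵇ inX G y ⌋ ∧ ⌊ E G x y ≟ᵇ b ⌋ ∧ stepsOK G ℓ u (y ∷ w)

lastV : ∀ {A : Set} {k} → Vec A (suc k) → A
lastV (x ∷ []) = x
lastV (x ∷ y ∷ w) = lastV (y ∷ w)

headV : ∀ {A : Set} {k} → Vec A (suc k) → A
headV (x ∷ _) = x

open import Data.Fin.Properties using () renaming (_≟_ to _≟ᶠ_)

obeys : ∀ {n} → BipartiteGraph n → ∀ ℓ → Vec Bool ℓ → Vec (Fin n) (suc ℓ) → Bool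
obeys G ℓ u w = ⌊ lastV w ≟ᶠ headV w ⌋ ∧ stepsOK G ℓ u w

-- |Ψ_{u,X}| (side = true) and |Ψ_{u,Y}| (side = false)
Ψcount : ∀ {n} → BipartiteGraph n → ∀ ℓ → Vec Bool ℓ → Bool → ℕ
Ψcount {n} G ℓ u side =
  length (filterᵇ (λ w → obeys G ℓ u w ∧ ⌊ inX G (headV w) ≟ᵇ side ⌋) (allSeqs n (suc ℓ)))

module Submission where

-- Walks are counted with transfer matrices.  A word over an alphabet of
-- "letters" (each letter a 0/1 matrix on the vertices) determines the walk
-- matrix 'walks w'; 'trace w c' counts the closed walks of shape w starting in
-- class c, and w is 'Balanced' when this does not depend on c.  Besides the
-- letters 'bit true' (an edge) and 'bit false' (a non-edge between the
-- classes) we use the letter 'cross' (any pair across the classes), which is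
-- the sum of the other two.  The general facts, valid for any letters that
-- only relate vertices of different classes, are:
--   * rotating the first letter of a word to its end swaps the start class,
--     so a word is balanced as soon as one of its rotations is;
--   * balancedness of two of the words  cross∷w, bit false∷w, bit true∷w
--     implies it for the third (linearity and cancellation);
--   * if every letter has constant row sums and the classes have equal size,
--     a word starting with the complete letter 'cross' is balanced.
-- For a d-regular graph (d ≥ 1) double counting gives |X| = |Y| and all row
-- sums are constant.  Induction on the pattern from the front, moving leading
-- ones to the end by rotation and splitting a leading zero as cross − one,
-- then shows that every word 'map bit u' is balanced, and a direct count
-- identifies |Ψ_{u,c}| with 'trace (map bit u) c'.

open import Defs
open import Data.Nat using (ℕ; zero; suc; _+_; _*_; _∸_; _≥_; >-nonZero)
open import Data.Nat.Properties
  using (+-*-semiring; *-commutativeSemigroup; +-identityʳ; *-identityʳ;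
         *-comm; *-assoc; *-distribˡ-+; *-distribʳ-+; +-cancelʳ-≡; *-cancelʳ-≡; m+n∸n≡m)
open import Algebra.Properties.Semiring.Sum +-*-semiring
  using (sum-syntax; sum-cong-≗; sum-replicate-zero; ∑-comm; ∑-distrib-+;
         *-distribˡ-sum; *-distribʳ-sum)
open import Algebra.Properties.CommutativeSemigroup *-commutativeSemigroup
  using () renaming (x∙yz≈y∙xz to *-swapˡ)
open import Data.Bool using (Bool; true; false; _∧_; not)
open import Data.Bool.Properties
  using (¬-not; ∧-assoc; ∧-comm; ∧-zeroʳ) renaming (_≟_ to _≟ᵇ_)
open import Data.Fin using (Fin; zero; suc)
open import Data.Fin.Properties using () renaming (_≟_ to _≟ᶠ_)
open import Data.Vec using (Vec; []; _∷_; toList)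
open import Data.List using (List; []; _∷_; [_]; _++_; map; concatMap; tabulate; filterᵇ; length; replicate)
open import Data.List.Properties using (++-assoc; ++-identityʳ)
open import Function using (id)
open import Relation.Binary.PropositionalEquality
  using (_≡_; refl; sym; trans; cong; cong₂; subst; module ≡-Reasoning)
open import Relation.Nullary using (¬_)
open import Relation.Nullary.Decidable using (Dec; ⌊_⌋; yes; no; dec-true; dec-false; isYes≗does; ⌊⌋-map′)

open ≡-Reasoning

𝟙 : Bool → ℕ
𝟙 true = 1
𝟙 false = 0

indicator-subst : ∀ b c (h : Bool → ℕ) → 𝟙 ⌊ b ≟ᵇ c ⌋ * h b ≡ 𝟙 ⌊ b ≟ᵇ c ⌋ * h c
indicator-subst true true h = refl
indicator-subst true false h = refl
indicator-subst false true h = refl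
indicator-subst false false h = refl

≟ᵇ-not : ∀ a c → ⌊ not a ≟ᵇ not c ⌋ ≡ ⌊ a ≟ᵇ c ⌋
≟ᵇ-not true true = refl
≟ᵇ-not true false = refl
≟ᵇ-not false true = refl
≟ᵇ-not false false = refl

∧-swapˡ : ∀ a b c → a ∧ (b ∧ c) ≡ b ∧ (a ∧ c)
∧-swapˡ true b c = refl
∧-swapˡ false true c = refl
∧-swapˡ false false c = refl

-- 'flips k b' is b negated k times: the class reached after k alternating steps.
flips : ℕ → Bool → Bool
flips zero b = b
flips (suc k) b = flips k (not b)

flips-shift : ∀ k b c → ⌊ flips k b ≟ᵇ c ⌋ ≡ ⌊ flips k (not b) ≟ᵇ not c ⌋
flips-shift zero b c = sym (≟ᵇ-not b c)
flips-shift (suc k) b c = flips-shift k (not b) c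

replicate-snoc : ∀ {A : Set} k (x : A) → replicate k x ++ [ x ] ≡ x ∷ replicate k x
replicate-snoc zero x = refl
replicate-snoc (suc k) x = cong (x ∷_) (replicate-snoc k x)

⌊⌋-yes : ∀ {P : Set} (p? : Dec P) → P → ⌊ p? ⌋ ≡ true
⌊⌋-yes p? p = trans (isYes≗does p?) (dec-true p? p)

⌊⌋-no : ∀ {P : Set} (p? : Dec P) → ¬ P → ⌊ p? ⌋ ≡ false
⌊⌋-no p? ¬p = trans (isYes≗does p?) (dec-false p? ¬p)

∑-pick : ∀ {n} (t : Fin n) (f : Fin n → ℕ) → ∑[ z < n ] (𝟙 ⌊ z ≟ᶠ t ⌋ * f z) ≡ f t
∑-pick {suc n} zero f =
  trans (cong₂ _+_ (+-identityʳ (f zero)) (sum-replicate-zero n)) (+-identityʳ (f zero))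
∑-pick {suc n} (suc t) f =
  trans (sum-cong-≗ (λ z → cong (λ b → 𝟙 b * f (suc z)) (⌊⌋-map′ _ _ (z ≟ᶠ t)))) (∑-pick t (λ z → f (suc z)))

∑-pick′ : ∀ {n} (t : Fin n) (f : Fin n → ℕ) → ∑[ z < n ] (𝟙 ⌊ t ≟ᶠ z ⌋ * f z) ≡ f t
∑-pick′ {suc n} zero f =
  trans (cong₂ _+_ (+-identityʳ (f zero)) (sum-replicate-zero n)) (+-identityʳ (f zero))
∑-pick′ {suc n} (suc t) f =
  trans (sum-cong-≗ (λ z → cong (λ b → 𝟙 b * f (suc z)) (⌊⌋-map′ _ _ (t ≟ᶠ z)))) (∑-pick′ t (λ z → f (suc z)))

∑-interchange : ∀ {m k} (f : Fin m → ℕ) (g : Fin m → Fin k → ℕ) →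
  ∑[ x < m ] (f x * ∑[ y < k ] g x y) ≡ ∑[ y < k ] ∑[ x < m ] (f x * g x y)
∑-interchange f g =
  trans (sum-cong-≗ (λ x → *-distribˡ-sum (f x) (g x))) (∑-comm (λ x y → f x * g x y))

count : {A : Set} → (A → Bool) → List A → ℕ
count p xs = length (filterᵇ p xs)

count-++ : ∀ {A : Set} (p : A → Bool) xs ys → count p (xs ++ ys) ≡ count p xs + count p ys
count-++ p [] ys = refl
count-++ p (x ∷ xs) ys with p x
... | true = cong suc (count-++ p xs ys)
... | false = count-++ p xs ys

count-map : ∀ {A B : Set} (p : B → Bool) (f : A → B) xs →
  count p (map f xs) ≡ count (λ x → p (f x)) xs
count-map p f [] = refl
count-map p f (x ∷ xs) with p (f x)
... | true = cong suc (count-map p f xs)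
... | false = count-map p f xs

count-cong : ∀ {A : Set} {p q : A → Bool} → (∀ x → p x ≡ q x) → ∀ xs → count p xs ≡ count q xs
count-cong eq [] = refl
count-cong {p = p} {q} eq (x ∷ xs) with p x | q x | eq x
... | true | true | _ = cong suc (count-cong eq xs)
... | false | false | _ = count-cong eq xs

count-∧ : ∀ {A : Set} c (p : A → Bool) xs → count (λ x → c ∧ p x) xs ≡ 𝟙 c * count p xs
count-∧ true p xs = sym (+-identityʳ (count p xs))
count-∧ false p xs = none xs
  where
  none : ∀ xs → count (λ _ → false) xs ≡ 0
  none [] = refl
  none (x ∷ xs) = none xs

count-tabulate : ∀ {m} {A : Set} (g : Fin m → A) (p : A → Bool) →
  count p (tabulate g) ≡ ∑[ i < m ] 𝟙 (p (g i))
count-tabulate {zero} g p = refl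
count-tabulate {suc m} g p with p (g zero)
... | true = cong suc (count-tabulate (λ i → g (suc i)) p)
... | false = count-tabulate (λ i → g (suc i)) p

count-concatMap : ∀ {m} {A B : Set} (g : Fin m → A) (f : A → List B) (p : B → Bool) →
  count p (concatMap f (tabulate g)) ≡ ∑[ i < m ] count p (f (g i))
count-concatMap {zero} g f p = refl
count-concatMap {suc m} g f p =
  trans (count-++ p (f (g zero)) _) (cong (count p (f (g zero)) +_) (count-concatMap (λ i → g (suc i)) f p))

count-allSeqs : ∀ {n} k (p : Vec (Fin n) (suc k) → Bool) →
  count p (allSeqs n (suc k)) ≡ ∑[ y < n ] count (λ w → p (y ∷ w)) (allSeqs n k)
count-allSeqs {n} k p =
  trans (count-concatMap id (λ y → map (y ∷_) (allSeqs n k)) p)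
        (sum-cong-≗ (λ y → count-map p (y ∷_) (allSeqs n k)))

-- Walk matrices for an alphabet L of ℕ-valued step matrices on n vertices:
-- 'walks w x t' counts the walks x → t whose i-th step is weighted by w_i.
module WalkMatrices {n : ℕ} {L : Set} (A : L → Fin n → Fin n → ℕ) where

  walks : List L → Fin n → Fin n → ℕ
  walks [] x t = 𝟙 ⌊ x ≟ᶠ t ⌋
  walks (a ∷ w) x t = ∑[ y < n ] (A a x y * walks w y t)

  walks-snoc : ∀ w a x t → walks (w ++ [ a ]) x t ≡ ∑[ y < n ] (walks w x y * A a y t)
  walks-snoc [] a x t = begin
    ∑[ z < n ] (A a x z * 𝟙 ⌊ z ≟ᶠ t ⌋)  ≡⟨ sum-cong-≗ (λ z → *-comm (A a x z) _) ⟩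
    ∑[ z < n ] (𝟙 ⌊ z ≟ᶠ t ⌋ * A a x z)  ≡⟨ ∑-pick t (A a x) ⟩
    A a x t                              ≡⟨ ∑-pick′ x (λ y → A a y t) ⟨
    ∑[ y < n ] (𝟙 ⌊ x ≟ᶠ y ⌋ * A a y t)  ∎
  walks-snoc (b ∷ w) a x t = begin
    ∑[ z < n ] (A b x z * walks (w ++ [ a ]) z t)
      ≡⟨ sum-cong-≗ (λ z → cong (A b x z *_) (walks-snoc w a z t)) ⟩
    ∑[ z < n ] (A b x z * ∑[ y < n ] (walks w z y * A a y t))
      ≡⟨ ∑-interchange (A b x) (λ z y → walks w z y * A a y t) ⟩
    ∑[ y < n ] ∑[ z < n ] (A b x z * (walks w z y * A a y t))
      ≡⟨ sum-cong-≗ (λ y → trans (sum-cong-≗ (λ z → sym (*-assoc (A b x z) _ _)))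
                                 (sym (*-distribʳ-sum (A a y t) (λ z → A b x z * walks w z y)))) ⟩
    ∑[ y < n ] (walks (b ∷ w) x y * A a y t) ∎

  walks-split : ∀ {a b b′} → (∀ x y → A a x y ≡ A b x y + A b′ x y) →
    ∀ w x t → walks (a ∷ w) x t ≡ walks (b ∷ w) x t + walks (b′ ∷ w) x t
  walks-split {a} {b} {b′} split w x t =
    trans (sum-cong-≗ (λ y → trans (cong (_* walks w y t) (split x y))
                                   (*-distribʳ-+ (walks w y t) (A b x y) (A b′ x y))))
          (∑-distrib-+ (λ y → A b x y * walks w y t) (λ y → A b′ x y * walks w y t))

  module Coloured (cls : Fin n → Bool) (across : ∀ a x y → cls x ≡ cls y → A a x y ≡ 0) where

    inClass : Bool → Fin n → ℕ
    inClass c x = 𝟙 ⌊ cls x ≟ᵇ c ⌋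

    classSize : Bool → ℕ
    classSize c = ∑[ x < n ] inClass c x

    trace : List L → Bool → ℕ
    trace w c = ∑[ x < n ] (inClass c x * walks w x x)

    Balanced : List L → Set
    Balanced w = ∀ c → trace w c ≡ trace w (not c)

    step-flips : ∀ a x y (h : Bool → ℕ) → A a x y * h (cls y) ≡ A a x y * h (not (cls x))
    step-flips a x y h with cls y ≟ᵇ cls x
    ... | yes same rewrite across a x y (sym same) = refl
    ... | no differ = cong (λ b → A a x y * h b) (¬-not differ)

    class-transfer : ∀ a x y c → inClass c x * A a x y ≡ inClass (not c) y * A a x y
    class-transfer a x y c = begin
      inClass c x * A a x y                       ≡⟨ *-comm (inClass c x) _ ⟩
      A a x y * 𝟙 ⌊ cls x ≟ᵇ c ⌋                  ≡⟨ cong (λ b → A a x y * 𝟙 b) (≟ᵇ-not (cls x) c) ⟨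
      A a x y * 𝟙 ⌊ not (cls x) ≟ᵇ not c ⌋        ≡⟨ step-flips a x y (λ b → 𝟙 ⌊ b ≟ᵇ not c ⌋) ⟨
      A a x y * inClass (not c) y                 ≡⟨ *-comm (A a x y) _ ⟩
      inClass (not c) y * A a x y                 ∎

    classSize-not : classSize true ≡ classSize false → ∀ c → classSize c ≡ classSize (not c)
    classSize-not sizes true = sizes
    classSize-not sizes false = sym sizes

    -- Double counting: a step matrix with all row and column sums equal to
    -- d ≠ 0 forces the two classes to have the same size.
    classSizes-equal : ∀ a d → d ≥ 1 → (∀ x → ∑[ y < n ] A a x y ≡ d) → (∀ y → ∑[ x < n ] A a x y ≡ d) →
      classSize true ≡ classSize false
    classSizes-equal a d d≥1 rows cols = *-cancelʳ-≡ _ _ d {{>-nonZero d≥1}} (begin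
      classSize true * d
        ≡⟨ *-distribʳ-sum d (inClass true) ⟩
      ∑[ x < n ] (inClass true x * d)
        ≡⟨ sum-cong-≗ (λ x → cong (inClass true x *_) (rows x)) ⟨
      ∑[ x < n ] (inClass true x * ∑[ y < n ] A a x y)
        ≡⟨ ∑-interchange (inClass true) (A a) ⟩
      ∑[ y < n ] ∑[ x < n ] (inClass true x * A a x y)
        ≡⟨ sum-cong-≗ (λ y → sum-cong-≗ (λ x → class-transfer a x y true)) ⟩
      ∑[ y < n ] ∑[ x < n ] (inClass false y * A a x y)
        ≡⟨ sum-cong-≗ (λ y → trans (sym (*-distribˡ-sum (inClass false y) (λ x → A a x y)))
                                   (cong (inClass false y *_) (cols y))) ⟩
      ∑[ y < n ] (inClass false y * d)
        ≡⟨ *-distribʳ-sum d (inClass false) ⟨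
      classSize false * d ∎)

    trace-empty : ∀ c → trace [] c ≡ classSize c
    trace-empty c = sum-cong-≗ (λ x →
      trans (cong (λ b → inClass c x * 𝟙 b) (⌊⌋-yes (x ≟ᶠ x) refl)) (*-identityʳ (inClass c x)))

    balanced-empty : classSize true ≡ classSize false → Balanced []
    balanced-empty sizes c =
      trans (trace-empty c) (trans (classSize-not sizes c) (sym (trace-empty (not c))))

    trace-rotate : ∀ a w c → trace (a ∷ w) c ≡ trace (w ++ [ a ]) (not c)
    trace-rotate a w c = begin
      ∑[ x < n ] (inClass c x * ∑[ y < n ] (A a x y * walks w y x))
        ≡⟨ ∑-interchange (inClass c) (λ x y → A a x y * walks w y x) ⟩
      ∑[ y < n ] ∑[ x < n ] (inClass c x * (A a x y * walks w y x))
        ≡⟨ sum-cong-≗ (λ y → sum-cong-≗ (λ x → move x y)) ⟩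
      ∑[ y < n ] ∑[ x < n ] (inClass (not c) y * (walks w y x * A a x y))
        ≡⟨ sum-cong-≗ (λ y → *-distribˡ-sum (inClass (not c) y) (λ x → walks w y x * A a x y)) ⟨
      ∑[ y < n ] (inClass (not c) y * ∑[ x < n ] (walks w y x * A a x y))
        ≡⟨ sum-cong-≗ (λ y → cong (inClass (not c) y *_) (walks-snoc w a y y)) ⟨
      trace (w ++ [ a ]) (not c) ∎
      where
      move : ∀ x y → inClass c x * (A a x y * walks w y x) ≡ inClass (not c) y * (walks w y x * A a x y)
      move x y = begin
        inClass c x * (A a x y * walks w y x)        ≡⟨ *-assoc (inClass c x) _ _ ⟨
        inClass c x * A a x y * walks w y x          ≡⟨ cong (_* walks w y x) (class-transfer a x y c) ⟩
        inClass (not c) y * A a x y * walks w y x    ≡⟨ *-assoc (inClass (not c) y) _ _ ⟩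
        inClass (not c) y * (A a x y * walks w y x)  ≡⟨ cong (inClass (not c) y *_) (*-comm (A a x y) _) ⟩
        inClass (not c) y * (walks w y x * A a x y)  ∎

    balanced-rotate : ∀ a w → Balanced (w ++ [ a ]) → Balanced (a ∷ w)
    balanced-rotate a w bal c = begin
      trace (a ∷ w) c                 ≡⟨ trace-rotate a w c ⟩
      trace (w ++ [ a ]) (not c)      ≡⟨ bal (not c) ⟩
      trace (w ++ [ a ]) (not (not c)) ≡⟨ trace-rotate a w (not c) ⟨
      trace (a ∷ w) (not c)           ∎

    balanced-split : ∀ {a b b′} → (∀ x y → A a x y ≡ A b x y + A b′ x y) →
      ∀ w → Balanced (a ∷ w) → Balanced (b′ ∷ w) → Balanced (b ∷ w)
    balanced-split {a} {b} {b′} split w bal bal′ c =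
      +-cancelʳ-≡ (trace (b′ ∷ w) c) (trace (b ∷ w) c) (trace (b ∷ w) (not c)) (begin
        trace (b ∷ w) c + trace (b′ ∷ w) c            ≡⟨ trace-split c ⟨
        trace (a ∷ w) c                               ≡⟨ bal c ⟩
        trace (a ∷ w) (not c)                         ≡⟨ trace-split (not c) ⟩
        trace (b ∷ w) (not c) + trace (b′ ∷ w) (not c) ≡⟨ cong (trace (b ∷ w) (not c) +_) (bal′ c) ⟨
        trace (b ∷ w) (not c) + trace (b′ ∷ w) c      ∎)
      where
      trace-split : ∀ c → trace (a ∷ w) c ≡ trace (b ∷ w) c + trace (b′ ∷ w) c
      trace-split c =
        trans (sum-cong-≗ (λ x → trans (cong (inClass c x *_) (walks-split split w x x))
                                       (*-distribˡ-+ (inClass c x) _ _)))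
              (∑-distrib-+ (λ x → inClass c x * walks (b ∷ w) x x) (λ x → inClass c x * walks (b′ ∷ w) x x))

    module ConstantRowSums (r : L → ℕ) (rowSum : ∀ a x → ∑[ y < n ] A a x y ≡ r a) where

      weight : List L → ℕ
      weight [] = 1
      weight (a ∷ w) = r a * weight w

      walks-into : ∀ w y c → ∑[ x < n ] (inClass c x * walks w y x) ≡ 𝟙 ⌊ flips (length w) (cls y) ≟ᵇ c ⌋ * weight w
      walks-into [] y c = begin
        ∑[ x < n ] (inClass c x * 𝟙 ⌊ y ≟ᶠ x ⌋)  ≡⟨ sum-cong-≗ (λ x → *-comm (inClass c x) _) ⟩
        ∑[ x < n ] (𝟙 ⌊ y ≟ᶠ x ⌋ * inClass c x)  ≡⟨ ∑-pick′ y (inClass c) ⟩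
        inClass c y                               ≡⟨ *-identityʳ (inClass c y) ⟨
        inClass c y * 1                           ∎
      walks-into (a ∷ w) y c = begin
        ∑[ x < n ] (inClass c x * ∑[ z < n ] (A a y z * walks w z x))
          ≡⟨ ∑-interchange (inClass c) (λ x z → A a y z * walks w z x) ⟩
        ∑[ z < n ] ∑[ x < n ] (inClass c x * (A a y z * walks w z x))
          ≡⟨ sum-cong-≗ (λ z → trans (sum-cong-≗ (λ x → *-swapˡ (inClass c x) (A a y z) _))
                                     (sym (*-distribˡ-sum (A a y z) (λ x → inClass c x * walks w z x)))) ⟩
        ∑[ z < n ] (A a y z * ∑[ x < n ] (inClass c x * walks w z x))
          ≡⟨ sum-cong-≗ (λ z → cong (A a y z *_) (walks-into w z c)) ⟩
        ∑[ z < n ] (A a y z * ending (cls z))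
          ≡⟨ sum-cong-≗ (λ z → step-flips a y z ending) ⟩
        ∑[ z < n ] (A a y z * ending (not (cls y)))
          ≡⟨ *-distribʳ-sum (ending (not (cls y))) (A a y) ⟨
        ∑[ z < n ] A a y z * ending (not (cls y))
          ≡⟨ cong (_* ending (not (cls y))) (rowSum a y) ⟩
        r a * ending (not (cls y))
          ≡⟨ *-swapˡ (r a) (𝟙 ⌊ flips (length w) (not (cls y)) ≟ᵇ c ⌋) (weight w) ⟩
        𝟙 ⌊ flips (length (a ∷ w)) (cls y) ≟ᵇ c ⌋ * weight (a ∷ w) ∎
        where
        ending : Bool → ℕ
        ending b = 𝟙 ⌊ flips (length w) b ≟ᵇ c ⌋ * weight w

      balanced-complete : ∀ κ → (∀ x y → A κ x y ≡ 𝟙 ⌊ cls y ≟ᵇ not (cls x) ⌋) →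
        classSize true ≡ classSize false → ∀ w → Balanced (κ ∷ w)
      balanced-complete κ complete sizes w c =
        trans (trace-complete c)
              (trans (cong₂ _*_ (classSize-not sizes (not c))
                                (cong (λ b → 𝟙 b * weight w) (flips-shift (length w) (not c) c)))
                     (sym (trace-complete (not c))))
        where
        ending : Bool → Bool → ℕ
        ending c b = 𝟙 ⌊ flips (length w) b ≟ᵇ c ⌋ * weight w

        first-step : ∀ c x y → inClass c x * A κ x y ≡ inClass (not c) y * inClass c x
        first-step c x y = begin
          inClass c x * A κ x y                     ≡⟨ cong (inClass c x *_) (complete x y) ⟩
          inClass c x * 𝟙 ⌊ cls y ≟ᵇ not (cls x) ⌋  ≡⟨ indicator-subst (cls x) c (λ b → 𝟙 ⌊ cls y ≟ᵇ not b ⌋) ⟩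
          inClass c x * inClass (not c) y           ≡⟨ *-comm (inClass c x) _ ⟩
          inClass (not c) y * inClass c x           ∎

        -- κ may go to any vertex of the other class, from which w must return to class c.
        trace-complete : ∀ c → trace (κ ∷ w) c ≡ classSize (not c) * ending c (not c)
        trace-complete c = begin
          ∑[ x < n ] (inClass c x * ∑[ y < n ] (A κ x y * walks w y x))
            ≡⟨ ∑-interchange (inClass c) (λ x y → A κ x y * walks w y x) ⟩
          ∑[ y < n ] ∑[ x < n ] (inClass c x * (A κ x y * walks w y x))
            ≡⟨ sum-cong-≗ (λ y → sum-cong-≗ (λ x →
                 trans (sym (*-assoc (inClass c x) _ _))
                       (trans (cong (_* walks w y x) (first-step c x y)) (*-assoc (inClass (not c) y) _ _)))) ⟩
          ∑[ y < n ] ∑[ x < n ] (inClass (not c) y * (inClass c x * walks w y x))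
            ≡⟨ sum-cong-≗ (λ y → *-distribˡ-sum (inClass (not c) y) (λ x → inClass c x * walks w y x)) ⟨
          ∑[ y < n ] (inClass (not c) y * ∑[ x < n ] (inClass c x * walks w y x))
            ≡⟨ sum-cong-≗ (λ y → cong (inClass (not c) y *_) (walks-into w y c)) ⟩
          ∑[ y < n ] (inClass (not c) y * ending c (cls y))
            ≡⟨ sum-cong-≗ (λ y → indicator-subst (cls y) (not c) (ending c)) ⟩
          ∑[ y < n ] (inClass (not c) y * ending c (not c))
            ≡⟨ *-distribʳ-sum (ending c (not c)) (inClass (not c)) ⟨
          classSize (not c) * ending c (not c) ∎

-- Letters for alternating walks in a bipartite graph: 'bit b' is a step
-- between the classes along an edge (b = true) or a non-edge (b = false);
-- 'cross' is any step between the classes.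
data Letter : Set where
  bit : Bool → Letter
  cross : Letter

word : ∀ {ℓ} → Vec Bool ℓ → List Letter
word u = map bit (toList u)

module GraphWalks {n : ℕ} (G : BipartiteGraph n) where

  -- 0/1 step matrices of the letters; 'bit b' is exactly one step of 'stepsOK'.
  stepMatrix : Letter → Fin n → Fin n → ℕ
  stepMatrix (bit b) x y = 𝟙 (not ⌊ inX G x ≟ᵇ inX G y ⌋ ∧ ⌊ E G x y ≟ᵇ b ⌋)
  stepMatrix cross x y = 𝟙 (not ⌊ inX G x ≟ᵇ inX G y ⌋)

  stepMatrix-across : ∀ a x y → inX G x ≡ inX G y → stepMatrix a x y ≡ 0
  stepMatrix-across (bit b) x y same rewrite same | ⌊⌋-yes (inX G y ≟ᵇ inX G y) refl = refl
  stepMatrix-across cross x y same rewrite same | ⌊⌋-yes (inX G y ≟ᵇ inX G y) refl = refl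

  stepMatrix-split : ∀ x y → stepMatrix cross x y ≡ stepMatrix (bit false) x y + stepMatrix (bit true) x y
  stepMatrix-split x y = split (not ⌊ inX G x ≟ᵇ inX G y ⌋) (E G x y)
    where
    split : ∀ s e → 𝟙 s ≡ 𝟙 (s ∧ ⌊ e ≟ᵇ false ⌋) + 𝟙 (s ∧ ⌊ e ≟ᵇ true ⌋)
    split false e = refl
    split true false = refl
    split true true = refl

  stepMatrix-cross : ∀ x y → stepMatrix cross x y ≡ 𝟙 ⌊ inX G y ≟ᵇ not (inX G x) ⌋
  stepMatrix-cross x y = cong 𝟙 (other (inX G x) (inX G y))
    where
    other : ∀ p q → not ⌊ p ≟ᵇ q ⌋ ≡ ⌊ q ≟ᵇ not p ⌋
    other true true = refl
    other true false = refl
    other false true = refl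
    other false false = refl

  -- In a bipartite graph every edge already joins the two classes.
  stepMatrix-edge : ∀ x y → stepMatrix (bit true) x y ≡ 𝟙 (E G x y)
  stepMatrix-edge x y with E G x y in edge
  ... | true rewrite ⌊⌋-no (inX G x ≟ᵇ inX G y) (E-bip G x y edge) = refl
  ... | false = cong 𝟙 (∧-zeroʳ (not ⌊ inX G x ≟ᵇ inX G y ⌋))

  open WalkMatrices stepMatrix public
  open Coloured (inX G) stepMatrix-across public

  walks-count : ∀ ℓ (u : Vec Bool ℓ) x t →
    count (λ w → ⌊ lastV (x ∷ w) ≟ᶠ t ⌋ ∧ stepsOK G ℓ u (x ∷ w)) (allSeqs n ℓ) ≡ walks (word u) x t
  walks-count zero [] x t with ⌊ x ≟ᶠ t ⌋
  ... | true = refl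
  ... | false = refl
  walks-count (suc ℓ) (b ∷ u) x t = begin
    count obeying (allSeqs n (suc ℓ))
      ≡⟨ count-allSeqs ℓ obeying ⟩
    ∑[ y < n ] count (λ w → obeying (y ∷ w)) (allSeqs n ℓ)
      ≡⟨ sum-cong-≗ (λ y → count-cong (λ w → first-step-out y w) (allSeqs n ℓ)) ⟩
    ∑[ y < n ] count (λ w → step y ∧ rest y w) (allSeqs n ℓ)
      ≡⟨ sum-cong-≗ (λ y → count-∧ (step y) (rest y) (allSeqs n ℓ)) ⟩
    ∑[ y < n ] (stepMatrix (bit b) x y * count (rest y) (allSeqs n ℓ))
      ≡⟨ sum-cong-≗ (λ y → cong (stepMatrix (bit b) x y *_) (walks-count ℓ u y t)) ⟩
    walks (word (b ∷ u)) x t ∎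
    where
    obeying : Vec (Fin n) (suc ℓ) → Bool
    obeying w = ⌊ lastV (x ∷ w) ≟ᶠ t ⌋ ∧ stepsOK G (suc ℓ) (b ∷ u) (x ∷ w)
    step : Fin n → Bool
    step y = not ⌊ inX G x ≟ᵇ inX G y ⌋ ∧ ⌊ E G x y ≟ᵇ b ⌋
    rest : Fin n → Vec (Fin n) ℓ → Bool
    rest y w = ⌊ lastV (y ∷ w) ≟ᶠ t ⌋ ∧ stepsOK G ℓ u (y ∷ w)
    first-step-out : ∀ y w → obeying (y ∷ w) ≡ step y ∧ rest y w
    first-step-out y w =
      trans (∧-swapˡ ends across-xy (edge-xy ∧ later))
            (trans (cong (across-xy ∧_) (∧-swapˡ ends edge-xy later))
                   (sym (∧-assoc across-xy edge-xy (ends ∧ later))))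
      where
      ends across-xy edge-xy later : Bool
      ends = ⌊ lastV (y ∷ w) ≟ᶠ t ⌋
      across-xy = not ⌊ inX G x ≟ᵇ inX G y ⌋
      edge-xy = ⌊ E G x y ≟ᵇ b ⌋
      later = stepsOK G ℓ u (y ∷ w)

  Ψcount-trace : ∀ ℓ (u : Vec Bool ℓ) c → Ψcount G ℓ u c ≡ trace (word u) c
  Ψcount-trace ℓ u c = begin
    Ψcount G ℓ u c
      ≡⟨ count-allSeqs ℓ (λ w → obeys G ℓ u w ∧ ⌊ inX G (headV w) ≟ᵇ c ⌋) ⟩
    ∑[ x < n ] count (λ w → closed x w ∧ ⌊ inX G x ≟ᵇ c ⌋) (allSeqs n ℓ)
      ≡⟨ sum-cong-≗ (λ x → count-cong (λ w → ∧-comm (closed x w) _) (allSeqs n ℓ)) ⟩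
    ∑[ x < n ] count (λ w → ⌊ inX G x ≟ᵇ c ⌋ ∧ closed x w) (allSeqs n ℓ)
      ≡⟨ sum-cong-≗ (λ x → count-∧ ⌊ inX G x ≟ᵇ c ⌋ (closed x) (allSeqs n ℓ)) ⟩
    ∑[ x < n ] (inClass c x * count (closed x) (allSeqs n ℓ))
      ≡⟨ sum-cong-≗ (λ x → cong (inClass c x *_) (walks-count ℓ u x x)) ⟩
    trace (word u) c ∎
    where
    closed : Fin n → Vec (Fin n) ℓ → Bool
    closed x w = ⌊ lastV (x ∷ w) ≟ᶠ x ⌋ ∧ stepsOK G ℓ u (x ∷ w)

  module RegularWalks (d : ℕ) (d≥1 : d ≥ 1) (reg : Regular G d) where

    edgeSum : ∀ x → ∑[ y < n ] stepMatrix (bit true) x y ≡ d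
    edgeSum x = trans (sum-cong-≗ (stepMatrix-edge x)) (trans (sym (count-tabulate id (E G x))) (reg x))

    -- |X| = |Y|, by double counting the edges (the edge matrix is symmetric).
    classSizes : classSize true ≡ classSize false
    classSizes = classSizes-equal (bit true) d d≥1 edgeSum (λ y → trans (sum-cong-≗ (λ x →
      trans (stepMatrix-edge x y) (trans (cong 𝟙 (E-sym G x y)) (sym (stepMatrix-edge y x))))) (edgeSum y))

    m : ℕ
    m = classSize true

    crossSum : ∀ x → ∑[ y < n ] stepMatrix cross x y ≡ m
    crossSum x = trans (sum-cong-≗ (stepMatrix-cross x)) (sizeOf (not (inX G x)))
      where
      sizeOf : ∀ c → classSize c ≡ m
      sizeOf true = refl
      sizeOf false = sym classSizes

    -- Every letter has constant row sums: d edges, m − d non-edges and m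
    -- vertices across from each vertex, where m = |X| = |Y|.
    rowLength : Letter → ℕ
    rowLength (bit true) = d
    rowLength (bit false) = m ∸ d
    rowLength cross = m

    rowSum : ∀ a x → ∑[ y < n ] stepMatrix a x y ≡ rowLength a
    rowSum (bit true) x = edgeSum x
    rowSum (bit false) x = begin
      nonEdges                                    ≡⟨ m+n∸n≡m nonEdges d ⟨
      nonEdges + d ∸ d                            ≡⟨ cong (λ k → nonEdges + k ∸ d) (edgeSum x) ⟨
      nonEdges + ∑[ y < n ] stepMatrix (bit true) x y ∸ d
        ≡⟨ cong (_∸ d) (trans (sym (∑-distrib-+ (stepMatrix (bit false) x) (stepMatrix (bit true) x)))
                              (sym (sum-cong-≗ (stepMatrix-split x)))) ⟩
      ∑[ y < n ] stepMatrix cross x y ∸ d         ≡⟨ cong (_∸ d) (crossSum x) ⟩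
      m ∸ d                                       ∎
      where
      nonEdges : ℕ
      nonEdges = ∑[ y < n ] stepMatrix (bit false) x y
    rowSum cross x = crossSum x

    open ConstantRowSums rowLength rowSum

    ones : ℕ → List Letter
    ones k = replicate k (bit true)

    -- The all-ones word is its own rotation.
    balanced-ones : ∀ k → Balanced (ones k)
    balanced-ones zero = balanced-empty classSizes
    balanced-ones (suc k) c =
      trans (trace-rotate (bit true) (ones k) c) (cong (λ w → trace w (not c)) (replicate-snoc k (bit true)))

    -- Induction on the pattern, collecting its leading ones at the end.
    balanced-suffix : ∀ bs k → Balanced (map bit bs ++ ones k)
    balanced-leading-one : ∀ bs k → Balanced (bit true ∷ (map bit bs ++ ones k))

    balanced-suffix [] k = balanced-ones k
    balanced-suffix (true ∷ bs) k = balanced-leading-one bs k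
    balanced-suffix (false ∷ bs) k =
      balanced-split {cross} {bit false} {bit true} stepMatrix-split (map bit bs ++ ones k)
        (balanced-complete cross stepMatrix-cross classSizes (map bit bs ++ ones k))
        (balanced-leading-one bs k)

    balanced-leading-one bs k =
      balanced-rotate (bit true) (map bit bs ++ ones k) (subst Balanced rotated (balanced-suffix bs (suc k)))
      where
      rotated : map bit bs ++ ones (suc k) ≡ (map bit bs ++ ones k) ++ [ bit true ]
      rotated = trans (cong (map bit bs ++_) (sym (replicate-snoc k (bit true))))
                      (sym (++-assoc (map bit bs) (ones k) [ bit true ]))

    balanced-word : ∀ bs → Balanced (map bit bs)
    balanced-word bs = subst Balanced (++-identityʳ (map bit bs)) (balanced-suffix bs 0)

lemma13 : (n d : ℕ) (G : BipartiteGraph n) → d ≥ 1 → Regular G d →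
    (ℓ : ℕ) (u : Vec Bool ℓ) → Ψcount G ℓ u true ≡ Ψcount G ℓ u false
lemma13 n d G d≥1 reg ℓ u = begin
  Ψcount G ℓ u true        ≡⟨ Ψcount-trace ℓ u true ⟩
  trace (word u) true      ≡⟨ balanced-word (toList u) true ⟩
  trace (word u) false     ≡⟨ Ψcount-trace ℓ u false ⟨
  Ψcount G ℓ u false       ∎
  where
  open GraphWalks G
  open RegularWalks d d≥1 reg
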